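{- Consider the Fitch-style calculus for Intuitionistic S4 interpreted in a cartesian closed category $\mathcal{C}$ with an adjunction $\Diamond\dashv\Box$ in which $\Box$ is an idempotent comonad. Let $D$ be a derivation of $\Gamma,\Gamma'\vdash t:A$ such that no variable of $\Gamma'$ is free in $t$, and let $D'$ be the derivation of $\Gamma\vdash t:A$ obtained by strengthening away $\Gamma'$. Then \[ \eta_{[\![A]\!]}\circ[\![D]\!] \;=\; \Diamond[\![D']\!]\circ(l_{\Gamma'})_{[\![\Gamma]\!]} \quad:\ [\![\Gamma,\Gamma']\!]\to\Diamond[\![A]\!]. \]
   Context: Calculus: types $A,B ::= p \mid 1 \mid A\times B \mid A\to B \mid \Box A$; contexts $\Gamma ::= \cdot \mid \Gamma,x:A \mid \Gamma,\bullet$ ($\bullet$ a structural symbol called a lock). Rules: (var) $\Gamma,x:A,\Gamma'\vdash x:A$ provided $\Gamma'$ contains no lock; usual rules for $1,\times,\to$; (shut) from $\Gamma,\bullet\vdash t:A$ infer $\Gamma\vdash\mathrm{shut}\,t:\Box A$; (open) from $\Gamma\vdash t:\Box A$ infer $\Gamma,\Gamma'\vdash\mathrm{open}\,t:A$ for any context $\Gamma'$. Strengthening: if $D$ derives $\Gamma,\Delta,\Gamma''\vdash t:B$ and no variable of $\Delta$ is free in $t$, the strengthened derivation of $\Gamma,\Gamma''\vdash t:B$ is obtained by deleting these occurrences of the entries of $\Delta$ (variables and locks) from every sequent of $D$ in which they occur. Semantics: $(\Diamond,\eta,\mu)$ is the monad induced by the comonad $\Box$ via the adjunction (unit $\eta^m$,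 counit $\varepsilon^m$); idempotence means each $\mu_X$ is an isomorphism with inverse $\eta_{\Diamond X}=\Diamond\eta_X$. Types are interpreted via the cartesian closed structure and $\Box$ (atoms arbitrary). A context $\Gamma$ denotes an endofunctor: $[\![\cdot]\!]=\mathrm{Id}$, $[\![\Gamma,x:A]\!](X)=[\![\Gamma]\!](X)\times[\![A]\!]$, $[\![\Gamma,\bullet]\!](X)=\Diamond[\![\Gamma]\!](X)$, and the object $[\![\Gamma]\!]=[\![\Gamma]\!](1)$, so $[\![\Gamma,\Gamma']\!]=[\![\Gamma']\!]([\![\Gamma]\!])$. Lock replacement $l_\Gamma:[\![\Gamma]\!]\Rightarrow\Diamond$: $l_\cdot=\eta$, $(l_{\Gamma,x:A})_X=(l_\Gamma)_X\circ\mathrm{pr}$, $(l_{\Gamma,\bullet})_X=\mu_X\circ\Diamond(l_\Gamma)_X$. A derivation $D$ of $\Gamma\vdash t:A$ denotes $[\![D]\!]:[\![\Gamma]\!]\to[\![A]\!]$ by induction: variables by projections, $1,\times,\to$ by the cartesian closed structure, $[\![\mathrm{shut}\,t]\!]=\Box[\![t]\!]\circ\eta^m_{[\![\Gamma]\!]}$, and $[\![\Gamma,\Gamma'\vdash\mathrm{open}\,t]\!]=\varepsilon^m_{[\![A]\!]}\circ\Diamond[\![t]\!]\circ(l_{\Gamma'})_{[\![\Gamma]\!]}$. -}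

module Defs where

open import Level using (Level; _⊔_) renaming (suc to lsuc)
open import Data.Nat using (ℕ)
open import Data.Product using (Σ; _,_)
open import Data.Maybe using (Maybe; just; nothing; _>>=_) renaming (map to mapMaybe)
open import Relation.Binary using (Rel; IsEquivalence)
open import Relation.Binary.PropositionalEquality using (_≡_)

infixr 30 _×ᵗ_
infixr 25 _⇒ᵗ_

data Ty : Set where
  atom  : ℕ → Ty
  𝟙ᵗ    : Ty
  _×ᵗ_  : Ty → Ty → Ty
  _⇒ᵗ_  : Ty → Ty → Ty
  □ᵗ    : Ty → Ty

infixl 20 _▹_ _▹•

-- contexts: empty, variable extension, lock
data Ctx : Set where
  ∅    : Ctx
  _▹_  : Ctx → Ty → Ctx
  _▹•  : Ctx → Ctx

-- Ext Γ Γ' Δ  :  Δ is the concatenation Γ,Γ'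
data Ext (Γ : Ctx) : Ctx → Ctx → Set where
  base : Ext Γ ∅ Γ
  ext  : ∀ {Γ' Δ A} → Ext Γ Γ' Δ → Ext Γ (Γ' ▹ A) (Δ ▹ A)
  extL : ∀ {Γ' Δ} → Ext Γ Γ' Δ → Ext Γ (Γ' ▹•) (Δ ▹•)

-- Variables usable by rule (var): no lock between the binder and the end
data Var : Ctx → Ty → Set where
  zero : ∀ {Γ A} → Var (Γ ▹ A) A
  suc  : ∀ {Γ A B} → Var Γ A → Var (Γ ▹ B) A

-- Derivations of Γ ⊢ t : A (the term is read off the derivation)
data Tm : Ctx → Ty → Set where
  var    : ∀ {Γ A} → Var Γ A → Tm Γ A
  unit   : ∀ {Γ} → Tm Γ 𝟙ᵗ
  pair   : ∀ {Γ A B} → Tm Γ A → Tm Γ B → Tm Γ (A ×ᵗ B)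
  fst    : ∀ {Γ A B} → Tm Γ (A ×ᵗ B) → Tm Γ A
  snd    : ∀ {Γ A B} → Tm Γ (A ×ᵗ B) → Tm Γ B
  lam    : ∀ {Γ A B} → Tm (Γ ▹ A) B → Tm Γ (A ⇒ᵗ B)
  app    : ∀ {Γ A B} → Tm Γ (A ⇒ᵗ B) → Tm Γ A → Tm Γ B
  shut   : ∀ {Γ A} → Tm (Γ ▹•) A → Tm Γ (□ᵗ A)
  open'  : ∀ {Γ Γ' Δ A} → Ext Γ Γ' Δ → Tm Γ (□ᵗ A) → Tm Δ A

-- variable entries of a context (positions, possibly behind locks)
data Mem : Ctx → Ty → Set where
  here   : ∀ {Γ A} → Mem (Γ ▹ A) A
  there  : ∀ {Γ A B} → Mem Γ A → Mem (Γ ▹ B) A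
  thereL : ∀ {Γ A} → Mem Γ A → Mem (Γ ▹•) A

toMem : ∀ {Γ A} → Var Γ A → Mem Γ A
toMem zero    = here
toMem (suc x) = there (toMem x)

inL : ∀ {Γ Γ' Δ B} → Ext Γ Γ' Δ → Mem Γ B → Mem Δ B
inL base     x = x
inL (ext e)  x = there (inL e x)
inL (extL e) x = thereL (inL e x)

inR : ∀ {Γ Γ' Δ B} → Ext Γ Γ' Δ → Mem Γ' B → Mem Δ B
inR base     ()
inR (ext e)  here       = here
inR (ext e)  (there x)  = there (inR e x)
inR (extL e) (thereL x) = thereL (inR e x)

data Free {Γ B} (x : Mem Γ B) : ∀ {A} → Tm Γ A → Set where
  fvar   : (y : Var Γ B) → toMem y ≡ x → Free x (var y)
  fpairˡ : ∀ {A C} {t : Tm Γ A} {u : Tm Γ C} → Free x t → Free x (pair t u)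
  fpairʳ : ∀ {A C} {t : Tm Γ A} {u : Tm Γ C} → Free x u → Free x (pair t u)
  ffst   : ∀ {A C} {t : Tm Γ (A ×ᵗ C)} → Free x t → Free x (fst t)
  fsnd   : ∀ {A C} {t : Tm Γ (A ×ᵗ C)} → Free x t → Free x (snd t)
  flam   : ∀ {A C} {t : Tm (Γ ▹ A) C} → Free (there x) t → Free x (lam t)
  fappˡ  : ∀ {A C} {t : Tm Γ (A ⇒ᵗ C)} {u : Tm Γ A} → Free x t → Free x (app t u)
  fappʳ  : ∀ {A C} {t : Tm Γ (A ⇒ᵗ C)} {u : Tm Γ A} → Free x u → Free x (app t u)
  fshut  : ∀ {A} {t : Tm (Γ ▹•) A} → Free (thereL x) t → Free x (shut t)
  fopen  : ∀ {Γ₁ Γ₂ A} (e : Ext Γ₁ Γ₂ Γ) {t : Tm Γ₁ (□ᵗ A)} (y : Mem Γ₁ B) →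
           inL e y ≡ x → Free y t → Free x (open' e t)

data Wk : Ctx → Ctx → Set where
  done  : Wk ∅ ∅
  keep  : ∀ {Θ Ξ A} → Wk Θ Ξ → Wk (Θ ▹ A) (Ξ ▹ A)
  drop  : ∀ {Θ Ξ A} → Wk Θ Ξ → Wk Θ (Ξ ▹ A)
  keepL : ∀ {Θ Ξ} → Wk Θ Ξ → Wk (Θ ▹•) (Ξ ▹•)
  dropL : ∀ {Θ Ξ} → Wk Θ Ξ → Wk Θ (Ξ ▹•)

idWk : ∀ Γ → Wk Γ Γ
idWk ∅       = done
idWk (Γ ▹ A) = keep (idWk Γ)
idWk (Γ ▹•)  = keepL (idWk Γ)

dropExt : ∀ {Γ Γ' Δ} → Ext Γ Γ' Δ → Wk Γ Δ
dropExt {Γ} base = idWk Γ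
dropExt (ext e)  = drop (dropExt e)
dropExt (extL e) = dropL (dropExt e)

record Split (Θ Ξ₁ : Ctx) : Set where
  constructor split
  field
    {Θ₁ Θ₂} : Ctx
    wk₁     : Wk Θ₁ Ξ₁
    ext₁    : Ext Θ₁ Θ₂ Θ

splitWk : ∀ {Θ Ξ Ξ₁ Ξ₂} → Wk Θ Ξ → Ext Ξ₁ Ξ₂ Ξ → Split Θ Ξ₁
splitWk w base = split w base
splitWk (keep w) (ext e) with splitWk w e
... | split w₁ e₁ = split w₁ (ext e₁)
splitWk (drop w) (ext e) = splitWk w e
splitWk (keepL w) (extL e) with splitWk w e
... | split w₁ e₁ = split w₁ (extL e₁)
splitWk (dropL w) (extL e) = splitWk w e

strVar : ∀ {Θ Ξ A} → Wk Θ Ξ → Var Ξ A → Maybe (Var Θ A)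
strVar (keep w) zero    = just zero
strVar (keep w) (suc x) = mapMaybe suc (strVar w x)
strVar (drop w) zero    = nothing
strVar (drop w) (suc x) = strVar w x

-- strengthening of a derivation; fails (nothing) iff a deleted variable is used
strengthen : ∀ {Θ Ξ A} → Wk Θ Ξ → Tm Ξ A → Maybe (Tm Θ A)
strengthen w (var x)    = mapMaybe var (strVar w x)
strengthen w unit       = just unit
strengthen w (pair t u) = strengthen w t >>= λ t' → strengthen w u >>= λ u' → just (pair t' u')
strengthen w (fst t)    = mapMaybe fst (strengthen w t)
strengthen w (snd t)    = mapMaybe snd (strengthen w t)
strengthen w (lam t)    = mapMaybe lam (strengthen (keep w) t)
strengthen w (app t u)  = strengthen w t >>= λ t' → strengthen w u >>= λ u' → just (app t' u')
strengthen w (shut t)   = mapMaybe shut (strengthen (keepL w) t)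
strengthen w (open' e t) with splitWk w e
... | split w₁ e₁ = mapMaybe (open' e₁) (strengthen w₁ t)

record Model (o ℓ e : Level) : Set (lsuc (o ⊔ ℓ ⊔ e)) where
  infixr 9 _∘_
  infix  4 _≈_
  infixr 7 _×_
  infixr 6 _⇒_
  field
    Obj  : Set o
    Hom  : Obj → Obj → Set ℓ
    _≈_  : ∀ {X Y} → Rel (Hom X Y) e
    ≈-equiv : ∀ {X Y} → IsEquivalence (_≈_ {X} {Y})
    id   : ∀ {X} → Hom X X
    _∘_  : ∀ {X Y Z} → Hom Y Z → Hom X Y → Hom X Z
    ∘-resp-≈  : ∀ {X Y Z} {f f' : Hom Y Z} {g g' : Hom X Y} → f ≈ f' → g ≈ g' → f ∘ g ≈ f' ∘ g'
    identityˡ : ∀ {X Y} {f : Hom X Y} → id ∘ f ≈ f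
    identityʳ : ∀ {X Y} {f : Hom X Y} → f ∘ id ≈ f
    assoc     : ∀ {W X Y Z} {f : Hom Y Z} {g : Hom X Y} {h : Hom W X} → (f ∘ g) ∘ h ≈ f ∘ (g ∘ h)
    ⊤        : Obj
    !        : ∀ {X} → Hom X ⊤
    !-unique : ∀ {X} (f : Hom X ⊤) → f ≈ !
    _×_       : Obj → Obj → Obj
    π₁        : ∀ {X Y} → Hom (X × Y) X
    π₂        : ∀ {X Y} → Hom (X × Y) Y
    ⟨_,_⟩     : ∀ {X Y Z} → Hom Z X → Hom Z Y → Hom Z (X × Y)
    project₁  : ∀ {X Y Z} {f : Hom Z X} {g : Hom Z Y} → π₁ ∘ ⟨ f , g ⟩ ≈ f
    project₂  : ∀ {X Y Z} {f : Hom Z X} {g : Hom Z Y} → π₂ ∘ ⟨ f , g ⟩ ≈ g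
    ⟨⟩-unique : ∀ {X Y Z} {f : Hom Z X} {g : Hom Z Y} {h : Hom Z (X × Y)} →
                π₁ ∘ h ≈ f → π₂ ∘ h ≈ g → h ≈ ⟨ f , g ⟩
    _⇒_       : Obj → Obj → Obj
    eval      : ∀ {Y Z} → Hom ((Y ⇒ Z) × Y) Z
    curry     : ∀ {X Y Z} → Hom (X × Y) Z → Hom X (Y ⇒ Z)
    β         : ∀ {X Y Z} {f : Hom (X × Y) Z} → eval ∘ ⟨ curry f ∘ π₁ , π₂ ⟩ ≈ f
    curry-unique : ∀ {X Y Z} {f : Hom (X × Y) Z} {h : Hom X (Y ⇒ Z)} →
                   eval ∘ ⟨ h ∘ π₁ , π₂ ⟩ ≈ f → h ≈ curry f
    ◇         : Obj → Obj
    ◇₁        : ∀ {X Y} → Hom X Y → Hom (◇ X) (◇ Y)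
    ◇-identity : ∀ {X} → ◇₁ (id {X}) ≈ id
    ◇-homo    : ∀ {X Y Z} {f : Hom Y Z} {g : Hom X Y} → ◇₁ (f ∘ g) ≈ ◇₁ f ∘ ◇₁ g
    ◇-resp-≈  : ∀ {X Y} {f g : Hom X Y} → f ≈ g → ◇₁ f ≈ ◇₁ g
    □         : Obj → Obj
    □₁        : ∀ {X Y} → Hom X Y → Hom (□ X) (□ Y)
    □-identity : ∀ {X} → □₁ (id {X}) ≈ id
    □-homo    : ∀ {X Y Z} {f : Hom Y Z} {g : Hom X Y} → □₁ (f ∘ g) ≈ □₁ f ∘ □₁ g
    □-resp-≈  : ∀ {X Y} {f g : Hom X Y} → f ≈ g → □₁ f ≈ □₁ g
    ηᵐ        : ∀ {X} → Hom X (□ (◇ X))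
    εᵐ        : ∀ {X} → Hom (◇ (□ X)) X
    ηᵐ-natural : ∀ {X Y} {f : Hom X Y} → □₁ (◇₁ f) ∘ ηᵐ ≈ ηᵐ ∘ f
    εᵐ-natural : ∀ {X Y} {f : Hom X Y} → f ∘ εᵐ ≈ εᵐ ∘ ◇₁ (□₁ f)
    zig       : ∀ {X} → εᵐ {◇ X} ∘ ◇₁ (ηᵐ {X}) ≈ id
    zag       : ∀ {X} → □₁ (εᵐ {X}) ∘ ηᵐ {□ X} ≈ id
    ε□        : ∀ {X} → Hom (□ X) X
    δ         : ∀ {X} → Hom (□ X) (□ (□ X))
    ε□-natural : ∀ {X Y} {f : Hom X Y} → f ∘ ε□ ≈ ε□ ∘ □₁ f
    δ-natural : ∀ {X Y} {f : Hom X Y} → □₁ (□₁ f) ∘ δ ≈ δ ∘ □₁ f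
    comonad-identityˡ : ∀ {X} → ε□ {□ X} ∘ δ {X} ≈ id
    comonad-identityʳ : ∀ {X} → □₁ (ε□ {X}) ∘ δ {X} ≈ id
    comonad-assoc     : ∀ {X} → δ {□ X} ∘ δ {X} ≈ □₁ (δ {X}) ∘ δ {X}
    -- idempotence: the comultiplication is an isomorphism
    δ⁻¹       : ∀ {X} → Hom (□ (□ X)) (□ X)
    δ⁻¹∘δ     : ∀ {X} → δ⁻¹ {X} ∘ δ ≈ id
    δ∘δ⁻¹     : ∀ {X} → δ {X} ∘ δ⁻¹ ≈ id

module Semantics {o ℓ e} (M : Model o ℓ e) (ρ : ℕ → Model.Obj M) where
  open Model M

  -- the monad (◇, η, μ) induced by the comonad □ via the adjunction (mates of ε□, δ)
  η : ∀ X → Hom X (◇ X)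
  η X = ε□ {◇ X} ∘ ηᵐ {X}

  μ : ∀ X → Hom (◇ (◇ X)) (◇ X)
  μ X = εᵐ {◇ X} ∘ ◇₁ (εᵐ {□ (◇ X)} ∘ ◇₁ (δ {◇ X} ∘ ηᵐ {X}))

  ⟦_⟧ᵀ : Ty → Obj
  ⟦ atom n ⟧ᵀ = ρ n
  ⟦ 𝟙ᵗ ⟧ᵀ     = ⊤
  ⟦ A ×ᵗ B ⟧ᵀ = ⟦ A ⟧ᵀ × ⟦ B ⟧ᵀ
  ⟦ A ⇒ᵗ B ⟧ᵀ = ⟦ A ⟧ᵀ ⇒ ⟦ B ⟧ᵀ
  ⟦ □ᵗ A ⟧ᵀ   = □ ⟦ A ⟧ᵀ

  -- ⟦ Γ ⟧ᶜ = [[Γ]](1)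
  ⟦_⟧ᶜ : Ctx → Obj
  ⟦ ∅ ⟧ᶜ     = ⊤
  ⟦ Γ ▹ A ⟧ᶜ = ⟦ Γ ⟧ᶜ × ⟦ A ⟧ᵀ
  ⟦ Γ ▹• ⟧ᶜ  = ◇ ⟦ Γ ⟧ᶜ

  -- lock replacement (l_{Γ'})_{[[Γ]]} : [[Γ,Γ']] → ◇[[Γ]]
  lock : ∀ {Γ Γ' Δ} → Ext Γ Γ' Δ → Hom ⟦ Δ ⟧ᶜ (◇ ⟦ Γ ⟧ᶜ)
  lock {Γ} base = η ⟦ Γ ⟧ᶜ
  lock (ext e)  = lock e ∘ π₁
  lock {Γ} (extL e) = μ ⟦ Γ ⟧ᶜ ∘ ◇₁ (lock e)

  ⟦_⟧ⱽ : ∀ {Γ A} → Var Γ A → Hom ⟦ Γ ⟧ᶜ ⟦ A ⟧ᵀ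
  ⟦ zero ⟧ⱽ  = π₂
  ⟦ suc x ⟧ⱽ = ⟦ x ⟧ⱽ ∘ π₁

  ⟦_⟧ : ∀ {Γ A} → Tm Γ A → Hom ⟦ Γ ⟧ᶜ ⟦ A ⟧ᵀ
  ⟦ var x ⟧     = ⟦ x ⟧ⱽ
  ⟦ unit ⟧      = !
  ⟦ pair t u ⟧  = ⟨ ⟦ t ⟧ , ⟦ u ⟧ ⟩
  ⟦ fst t ⟧     = π₁ ∘ ⟦ t ⟧
  ⟦ snd t ⟧     = π₂ ∘ ⟦ t ⟧
  ⟦ lam t ⟧     = curry ⟦ t ⟧
  ⟦ app t u ⟧   = eval ∘ ⟨ ⟦ t ⟧ , ⟦ u ⟧ ⟩
  ⟦ shut t ⟧    = □₁ ⟦ t ⟧ ∘ ηᵐ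
  ⟦ open' e t ⟧ = εᵐ ∘ ◇₁ ⟦ t ⟧ ∘ lock e

-- Deleting context entries has no semantic counterpart ⟦ Γ , Γ' ⟧ → ⟦ Γ ⟧, since a
-- deleted lock would need a map ◇ X → X.  Both contexts do map into the context
-- obtained from Γ , Γ' by deleting only the variables of Γ' and keeping its locks:
-- the larger one by projecting variables away, the smaller one by inserting a
-- unit η at each deleted lock.  By induction on D, the interpretations of D and
-- of its strengthening factor through these two maps via a common morphism.  It
-- remains to show η ∘ projection ≈ ◇ insertion ∘ l_Γ', by induction on Γ'; at a
-- lock this uses μ ∘ ◇ η ≈ id together with idempotence, η (◇ X) ≈ ◇ (η X).

module Submission where

open import Defs
open import Level using (_⊔_)
open import Data.Nat using (ℕ)
open import Data.Product using (Σ; _,_)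
import Data.Product as Product
open import Data.Maybe using (Maybe; just; _>>=_)
open import Data.Maybe.Properties using (map-just)
open import Data.Maybe.Relation.Unary.All as All using (All; just; nothing; drop-just)
open import Data.Maybe.Relation.Unary.All.Properties using (map⁺; gmap)
open import Data.Empty using (⊥-elim)
open import Relation.Nullary using (¬_)
open import Relation.Binary using (IsEquivalence; Setoid)
open import Relation.Binary.PropositionalEquality using (_≡_; refl; subst)
import Relation.Binary.Reasoning.Setoid as SetoidReasoning

data Deleted : ∀ {Θ Ξ} → Wk Θ Ξ → ∀ {B} → Mem Ξ B → Set where
  here  : ∀ {Θ Ξ A} {w : Wk Θ Ξ} → Deleted (drop {A = A} w) here
  drop  : ∀ {Θ Ξ A B} {w : Wk Θ Ξ} {x : Mem Ξ B} → Deleted w x → Deleted (drop {A = A} w) (there x)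
  keep  : ∀ {Θ Ξ A B} {w : Wk Θ Ξ} {x : Mem Ξ B} → Deleted w x → Deleted (keep {A = A} w) (there x)
  dropL : ∀ {Θ Ξ B} {w : Wk Θ Ξ} {x : Mem Ξ B} → Deleted w x → Deleted (dropL w) (thereL x)
  keepL : ∀ {Θ Ξ B} {w : Wk Θ Ξ} {x : Mem Ξ B} → Deleted w x → Deleted (keepL w) (thereL x)

Avoids : ∀ {Θ Ξ A} → Wk Θ Ξ → Tm Ξ A → Set
Avoids {Ξ = Ξ} w D = ∀ {B} {x : Mem Ξ B} → Deleted w x → ¬ Free x D

bind-just : ∀ {a b} {A : Set a} {B : Set b} {m : Maybe A} {x : A} {f : A → Maybe B} {r : Maybe B} →
            m ≡ just x → f x ≡ r → (m >>= f) ≡ r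
bind-just refl fx≡r = fx≡r

>>=⁺ : ∀ {a b p q} {A : Set a} {B : Set b} {P : A → Set p} {Q : B → Set q}
       {m : Maybe A} {f : A → Maybe B} → All P m → (∀ {x} → P x → All Q (f x)) → All Q (m >>= f)
>>=⁺ (just px) k = k px
>>=⁺ nothing   k = nothing

strVar-just : ∀ {Θ Ξ A} (w : Wk Θ Ξ) (x : Var Ξ A) → ¬ Deleted w (toMem x) →
              Σ (Var Θ A) λ x' → strVar w x ≡ just x'
strVar-just (keep w) zero    _    = zero , refl
strVar-just (keep w) (suc x) ¬del = Product.map suc map-just (strVar-just w x λ del → ¬del (keep del))
strVar-just (drop w) zero    ¬del = ⊥-elim (¬del here)
strVar-just (drop w) (suc x) ¬del = strVar-just w x λ del → ¬del (drop del)

Deleted-splitWk : ∀ {Θ Ξ Ξ₁ Ξ₂} (w : Wk Θ Ξ) (e : Ext Ξ₁ Ξ₂ Ξ) {B} {y : Mem Ξ₁ B} →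
                  Deleted (Split.wk₁ (splitWk w e)) y → Deleted w (inL e y)
Deleted-splitWk w base del = del
Deleted-splitWk (keep w) (ext e) del with splitWk w e | (λ {B} {y} → Deleted-splitWk w e {B} {y})
... | split _ _ | lift = keep (lift del)
Deleted-splitWk (drop w) (ext e) del = drop (Deleted-splitWk w e del)
Deleted-splitWk (keepL w) (extL e) del with splitWk w e | (λ {B} {y} → Deleted-splitWk w e {B} {y})
... | split _ _ | lift = keepL (lift del)
Deleted-splitWk (dropL w) (extL e) del = dropL (Deleted-splitWk w e del)

strengthen-just : ∀ {Θ Ξ A} (w : Wk Θ Ξ) (D : Tm Ξ A) → Avoids w D →
                  Σ (Tm Θ A) λ D' → strengthen w D ≡ just D'
strengthen-just w (var x) av = Product.map var map-just (strVar-just w x λ del → av del (fvar x refl))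
strengthen-just w unit av = unit , refl
strengthen-just w (pair t u) av
  with strengthen-just w t (λ del f → av del (fpairˡ f)) | strengthen-just w u (λ del f → av del (fpairʳ f))
... | t' , t≡ | u' , u≡ = pair t' u' , bind-just t≡ (bind-just u≡ refl)
strengthen-just w (fst t) av = Product.map fst map-just (strengthen-just w t λ del f → av del (ffst f))
strengthen-just w (snd t) av = Product.map snd map-just (strengthen-just w t λ del f → av del (fsnd f))
strengthen-just w (lam t) av =
  Product.map lam map-just (strengthen-just (keep w) t λ { (keep del) f → av del (flam f) })
strengthen-just w (app t u) av
  with strengthen-just w t (λ del f → av del (fappˡ f)) | strengthen-just w u (λ del f → av del (fappʳ f))
... | t' , t≡ | u' , u≡ = app t' u' , bind-just t≡ (bind-just u≡ refl)
strengthen-just w (shut t) av =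
  Product.map shut map-just (strengthen-just (keepL w) t λ { (keepL del) f → av del (fshut f) })
strengthen-just w (open' e t) av with splitWk w e | (λ {B} {y} → Deleted-splitWk w e {B} {y})
... | split w₁ e₁ | lift =
  Product.map (open' e₁) map-just (strengthen-just w₁ t λ {_} {y} del f → av (lift del) (fopen e y refl f))

idWk-deletes-nothing : ∀ Γ {B} {x : Mem Γ B} → ¬ Deleted (idWk Γ) x
idWk-deletes-nothing (Γ ▹ A) (keep del)  = idWk-deletes-nothing Γ del
idWk-deletes-nothing (Γ ▹•)  (keepL del) = idWk-deletes-nothing Γ del

Deleted-dropExt : ∀ {Γ Γ' Δ B} (E : Ext Γ Γ' Δ) {x : Mem Δ B} → Deleted (dropExt E) x →
                  Σ (Mem Γ' B) λ y → inR E y ≡ x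
Deleted-dropExt {Γ} base del = ⊥-elim (idWk-deletes-nothing Γ del)
Deleted-dropExt (ext E) here = here , refl
Deleted-dropExt (ext E) (drop del) with Deleted-dropExt E del
... | y , refl = there y , refl
Deleted-dropExt (extL E) (dropL del) with Deleted-dropExt E del
... | y , refl = thereL y , refl

dropExt-avoids : ∀ {Γ Γ' Δ A} (E : Ext Γ Γ' Δ) {D : Tm Δ A} →
                 (∀ {B} (x : Mem Γ' B) → ¬ Free (inR E x) D) → Avoids (dropExt E) D
dropExt-avoids E avoids del with Deleted-dropExt E del
... | y , refl = avoids y

keepLocks : ∀ {Θ Ξ} → Wk Θ Ξ → Ctx
keepLocks done             = ∅
keepLocks (keep {A = A} w) = keepLocks w ▹ A
keepLocks (drop w)         = keepLocks w
keepLocks (keepL w)        = keepLocks w ▹•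
keepLocks (dropL w)        = keepLocks w ▹•

module _ {o ℓ ℓ′} (M : Model o ℓ ℓ′) (ρ : ℕ → Model.Obj M) where
  open Model M
  open Semantics M ρ

  module ≈ {X Y} = IsEquivalence (≈-equiv {X} {Y})

  hom-setoid : ∀ {X Y} → Setoid ℓ ℓ′
  hom-setoid {X} {Y} = record { Carrier = Hom X Y ; _≈_ = _≈_ ; isEquivalence = ≈-equiv }

  module HomReasoning {X Y} = SetoidReasoning (hom-setoid {X} {Y})
  open HomReasoning

  ∘-resp-≈ˡ : ∀ {X Y Z} {f f' : Hom Y Z} {g : Hom X Y} → f ≈ f' → f ∘ g ≈ f' ∘ g
  ∘-resp-≈ˡ p = ∘-resp-≈ p ≈.refl

  ∘-resp-≈ʳ : ∀ {X Y Z} {f : Hom Y Z} {g g' : Hom X Y} → g ≈ g' → f ∘ g ≈ f ∘ g'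
  ∘-resp-≈ʳ p = ∘-resp-≈ ≈.refl p

  sym-assoc : ∀ {W X Y Z} {f : Hom Y Z} {g : Hom X Y} {h : Hom W X} → f ∘ (g ∘ h) ≈ (f ∘ g) ∘ h
  sym-assoc = ≈.sym assoc

  first : ∀ {X Y Z} → Hom X Y → Hom (X × Z) (Y × Z)
  first f = ⟨ f ∘ π₁ , π₂ ⟩

  ⟨⟩∘ : ∀ {W X Y Z} {f : Hom Z X} {g : Hom Z Y} {h : Hom W Z} → ⟨ f , g ⟩ ∘ h ≈ ⟨ f ∘ h , g ∘ h ⟩
  ⟨⟩∘ = ⟨⟩-unique (≈.trans sym-assoc (∘-resp-≈ˡ project₁)) (≈.trans sym-assoc (∘-resp-≈ˡ project₂))

  ⟨⟩-cong : ∀ {X Y Z} {f f' : Hom Z X} {g g' : Hom Z Y} → f ≈ f' → g ≈ g' → ⟨ f , g ⟩ ≈ ⟨ f' , g' ⟩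
  ⟨⟩-cong p q = ⟨⟩-unique (≈.trans project₁ p) (≈.trans project₂ q)

  first∘first : ∀ {X Y Z W} {f : Hom Y Z} {g : Hom X Y} → first {Z = W} f ∘ first g ≈ first (f ∘ g)
  first∘first {f = f} {g} = begin
    first f ∘ first g                       ≈⟨ ⟨⟩∘ ⟩
    ⟨ (f ∘ π₁) ∘ first g , π₂ ∘ first g ⟩   ≈⟨ ⟨⟩-cong (≈.trans assoc (∘-resp-≈ʳ project₁)) project₂ ⟩
    ⟨ f ∘ (g ∘ π₁) , π₂ ⟩                   ≈⟨ ⟨⟩-cong sym-assoc ≈.refl ⟩
    first (f ∘ g)                           ∎

  curry∘ : ∀ {W X Y Z} {h : Hom (X × Y) Z} {g : Hom W X} → curry h ∘ g ≈ curry (h ∘ first g)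
  curry∘ {h = h} {g} = curry-unique (begin
    eval ∘ first (curry h ∘ g)              ≈⟨ ∘-resp-≈ʳ first∘first ⟨
    eval ∘ (first (curry h) ∘ first g)      ≈⟨ sym-assoc ⟩
    (eval ∘ first (curry h)) ∘ first g      ≈⟨ ∘-resp-≈ˡ β ⟩
    h ∘ first g                             ∎)

  curry-cong : ∀ {X Y Z} {f f' : Hom (X × Y) Z} → f ≈ f' → curry f ≈ curry f'
  curry-cong p = curry-unique (≈.trans β p)

  ∘π₁≈π₁∘first : ∀ {W X Y Z} {f : Hom Y Z} {g : Hom X Y} → (f ∘ g) ∘ π₁ {X} {W} ≈ (f ∘ π₁) ∘ first g
  ∘π₁≈π₁∘first {f = f} {g} = begin
    (f ∘ g) ∘ π₁            ≈⟨ assoc ⟩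
    f ∘ (g ∘ π₁)            ≈⟨ ∘-resp-≈ʳ project₁ ⟨
    f ∘ (π₁ ∘ first g)      ≈⟨ sym-assoc ⟩
    (f ∘ π₁) ∘ first g      ∎

  δ-left-inverse-unique : ∀ {Y} {f : Hom (□ (□ Y)) (□ Y)} → f ∘ δ ≈ id → f ≈ δ⁻¹
  δ-left-inverse-unique {f = f} f∘δ≈id = begin
    f               ≈⟨ identityʳ ⟨
    f ∘ id          ≈⟨ ∘-resp-≈ʳ δ∘δ⁻¹ ⟨
    f ∘ (δ ∘ δ⁻¹)   ≈⟨ sym-assoc ⟩
    (f ∘ δ) ∘ δ⁻¹   ≈⟨ ∘-resp-≈ˡ f∘δ≈id ⟩
    id ∘ δ⁻¹        ≈⟨ identityˡ ⟩
    δ⁻¹             ∎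

  ε□-idempotent : ∀ {Y} → ε□ {□ Y} ≈ □₁ (ε□ {Y})
  ε□-idempotent = ≈.trans (δ-left-inverse-unique comonad-identityˡ)
                          (≈.sym (δ-left-inverse-unique comonad-identityʳ))

  adjunct-inverseˡ : ∀ {X Y} {f : Hom (◇ X) Y} → εᵐ ∘ ◇₁ (□₁ f ∘ ηᵐ) ≈ f
  adjunct-inverseˡ {f = f} = begin
    εᵐ ∘ ◇₁ (□₁ f ∘ ηᵐ)         ≈⟨ ∘-resp-≈ʳ ◇-homo ⟩
    εᵐ ∘ (◇₁ (□₁ f) ∘ ◇₁ ηᵐ)    ≈⟨ sym-assoc ⟩
    (εᵐ ∘ ◇₁ (□₁ f)) ∘ ◇₁ ηᵐ    ≈⟨ ∘-resp-≈ˡ εᵐ-natural ⟨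
    (f ∘ εᵐ) ∘ ◇₁ ηᵐ            ≈⟨ assoc ⟩
    f ∘ (εᵐ ∘ ◇₁ ηᵐ)            ≈⟨ ∘-resp-≈ʳ zig ⟩
    f ∘ id                      ≈⟨ identityʳ ⟩
    f                           ∎

  adjunct-inverseʳ : ∀ {X Y} {g : Hom X (□ Y)} → □₁ (εᵐ ∘ ◇₁ g) ∘ ηᵐ ≈ g
  adjunct-inverseʳ {g = g} = begin
    □₁ (εᵐ ∘ ◇₁ g) ∘ ηᵐ         ≈⟨ ∘-resp-≈ˡ □-homo ⟩
    (□₁ εᵐ ∘ □₁ (◇₁ g)) ∘ ηᵐ    ≈⟨ assoc ⟩
    □₁ εᵐ ∘ (□₁ (◇₁ g) ∘ ηᵐ)    ≈⟨ ∘-resp-≈ʳ ηᵐ-natural ⟩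
    □₁ εᵐ ∘ (ηᵐ ∘ g)            ≈⟨ sym-assoc ⟩
    (□₁ εᵐ ∘ ηᵐ) ∘ g            ≈⟨ ∘-resp-≈ˡ zag ⟩
    id ∘ g                      ≈⟨ identityˡ ⟩
    g                           ∎

  η-natural : ∀ {X Y} {f : Hom X Y} → η Y ∘ f ≈ ◇₁ f ∘ η X
  η-natural {f = f} = begin
    (ε□ ∘ ηᵐ) ∘ f           ≈⟨ assoc ⟩
    ε□ ∘ (ηᵐ ∘ f)           ≈⟨ ∘-resp-≈ʳ ηᵐ-natural ⟨
    ε□ ∘ (□₁ (◇₁ f) ∘ ηᵐ)   ≈⟨ sym-assoc ⟩
    (ε□ ∘ □₁ (◇₁ f)) ∘ ηᵐ   ≈⟨ ∘-resp-≈ˡ ε□-natural ⟨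
    (◇₁ f ∘ ε□) ∘ ηᵐ        ≈⟨ assoc ⟩
    ◇₁ f ∘ (ε□ ∘ ηᵐ)        ∎

  η-idempotent : ∀ {X} → η (◇ X) ≈ ◇₁ (η X)
  η-idempotent {X} = begin
    η (◇ X)                          ≈⟨ adjunct-inverseˡ ⟨
    εᵐ ∘ ◇₁ (□₁ (η (◇ X)) ∘ ηᵐ)      ≈⟨ ∘-resp-≈ʳ (◇-resp-≈ transposes-agree) ⟩
    εᵐ ∘ ◇₁ (□₁ (◇₁ (η X)) ∘ ηᵐ)     ≈⟨ adjunct-inverseˡ ⟩
    ◇₁ (η X)                         ∎
    where
    transposes-agree : □₁ (η (◇ X)) ∘ ηᵐ ≈ □₁ (◇₁ (η X)) ∘ ηᵐ
    transposes-agree = begin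
      □₁ (ε□ ∘ ηᵐ) ∘ ηᵐ        ≈⟨ ∘-resp-≈ˡ □-homo ⟩
      (□₁ ε□ ∘ □₁ ηᵐ) ∘ ηᵐ     ≈⟨ ∘-resp-≈ˡ (∘-resp-≈ˡ ε□-idempotent) ⟨
      (ε□ ∘ □₁ ηᵐ) ∘ ηᵐ        ≈⟨ ∘-resp-≈ˡ ε□-natural ⟨
      (ηᵐ ∘ ε□) ∘ ηᵐ           ≈⟨ assoc ⟩
      ηᵐ ∘ η X                 ≈⟨ ηᵐ-natural ⟨
      □₁ (◇₁ (η X)) ∘ ηᵐ       ∎

  -- μ X is εᵐ ∘ ◇₁ (κ X) by definition.
  κ : ∀ X → Hom (◇ X) (□ (◇ X))
  κ X = εᵐ ∘ ◇₁ (δ ∘ ηᵐ)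

  κ-natural : ∀ {X Y} {f : Hom X Y} → □₁ (◇₁ f) ∘ κ X ≈ κ Y ∘ ◇₁ f
  κ-natural {f = f} = begin
    □₁ (◇₁ f) ∘ (εᵐ ∘ ◇₁ (δ ∘ ηᵐ))             ≈⟨ sym-assoc ⟩
    (□₁ (◇₁ f) ∘ εᵐ) ∘ ◇₁ (δ ∘ ηᵐ)             ≈⟨ ∘-resp-≈ˡ εᵐ-natural ⟩
    (εᵐ ∘ ◇₁ (□₁ (□₁ (◇₁ f)))) ∘ ◇₁ (δ ∘ ηᵐ)   ≈⟨ assoc ⟩
    εᵐ ∘ (◇₁ (□₁ (□₁ (◇₁ f))) ∘ ◇₁ (δ ∘ ηᵐ))   ≈⟨ ∘-resp-≈ʳ ◇-homo ⟨
    εᵐ ∘ ◇₁ (□₁ (□₁ (◇₁ f)) ∘ (δ ∘ ηᵐ))        ≈⟨ ∘-resp-≈ʳ (◇-resp-≈ δ∘ηᵐ-natural) ⟩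
    εᵐ ∘ ◇₁ ((δ ∘ ηᵐ) ∘ f)                     ≈⟨ ∘-resp-≈ʳ ◇-homo ⟩
    εᵐ ∘ (◇₁ (δ ∘ ηᵐ) ∘ ◇₁ f)                  ≈⟨ sym-assoc ⟩
    (εᵐ ∘ ◇₁ (δ ∘ ηᵐ)) ∘ ◇₁ f                  ∎
    where
    δ∘ηᵐ-natural : □₁ (□₁ (◇₁ f)) ∘ (δ ∘ ηᵐ) ≈ (δ ∘ ηᵐ) ∘ f
    δ∘ηᵐ-natural = begin
      □₁ (□₁ (◇₁ f)) ∘ (δ ∘ ηᵐ)  ≈⟨ sym-assoc ⟩
      (□₁ (□₁ (◇₁ f)) ∘ δ) ∘ ηᵐ  ≈⟨ ∘-resp-≈ˡ δ-natural ⟩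
      (δ ∘ □₁ (◇₁ f)) ∘ ηᵐ       ≈⟨ assoc ⟩
      δ ∘ (□₁ (◇₁ f) ∘ ηᵐ)       ≈⟨ ∘-resp-≈ʳ ηᵐ-natural ⟩
      δ ∘ (ηᵐ ∘ f)               ≈⟨ sym-assoc ⟩
      (δ ∘ ηᵐ) ∘ f               ∎

  μ-natural : ∀ {X Y} {f : Hom X Y} → ◇₁ f ∘ μ X ≈ μ Y ∘ ◇₁ (◇₁ f)
  μ-natural {X} {Y} {f} = begin
    ◇₁ f ∘ (εᵐ ∘ ◇₁ (κ X))            ≈⟨ sym-assoc ⟩
    (◇₁ f ∘ εᵐ) ∘ ◇₁ (κ X)            ≈⟨ ∘-resp-≈ˡ εᵐ-natural ⟩
    (εᵐ ∘ ◇₁ (□₁ (◇₁ f))) ∘ ◇₁ (κ X)  ≈⟨ assoc ⟩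
    εᵐ ∘ (◇₁ (□₁ (◇₁ f)) ∘ ◇₁ (κ X))  ≈⟨ ∘-resp-≈ʳ ◇-homo ⟨
    εᵐ ∘ ◇₁ (□₁ (◇₁ f) ∘ κ X)         ≈⟨ ∘-resp-≈ʳ (◇-resp-≈ κ-natural) ⟩
    εᵐ ∘ ◇₁ (κ Y ∘ ◇₁ f)              ≈⟨ ∘-resp-≈ʳ ◇-homo ⟩
    εᵐ ∘ (◇₁ (κ Y) ∘ ◇₁ (◇₁ f))       ≈⟨ sym-assoc ⟩
    (εᵐ ∘ ◇₁ (κ Y)) ∘ ◇₁ (◇₁ f)       ∎

  κ∘η : ∀ {X} → κ X ∘ η X ≈ ηᵐ
  κ∘η {X} = begin
    κ X ∘ (ε□ ∘ ηᵐ)        ≈⟨ sym-assoc ⟩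
    (κ X ∘ ε□) ∘ ηᵐ        ≈⟨ ∘-resp-≈ˡ ε□-natural ⟩
    (ε□ ∘ □₁ (κ X)) ∘ ηᵐ   ≈⟨ assoc ⟩
    ε□ ∘ (□₁ (κ X) ∘ ηᵐ)   ≈⟨ ∘-resp-≈ʳ adjunct-inverseʳ ⟩
    ε□ ∘ (δ ∘ ηᵐ)          ≈⟨ sym-assoc ⟩
    (ε□ ∘ δ) ∘ ηᵐ          ≈⟨ ∘-resp-≈ˡ comonad-identityˡ ⟩
    id ∘ ηᵐ                ≈⟨ identityˡ ⟩
    ηᵐ                     ∎

  μ∘◇η : ∀ {X} → μ X ∘ ◇₁ (η X) ≈ id
  μ∘◇η {X} = begin
    (εᵐ ∘ ◇₁ (κ X)) ∘ ◇₁ (η X)   ≈⟨ assoc ⟩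
    εᵐ ∘ (◇₁ (κ X) ∘ ◇₁ (η X))   ≈⟨ ∘-resp-≈ʳ ◇-homo ⟨
    εᵐ ∘ ◇₁ (κ X ∘ η X)          ≈⟨ ∘-resp-≈ʳ (◇-resp-≈ κ∘η) ⟩
    εᵐ ∘ ◇₁ ηᵐ                   ≈⟨ zig ⟩
    id                           ∎

  μ∘◇₁f∘η : ∀ {X Y} {f : Hom X (◇ Y)} → (μ Y ∘ ◇₁ f) ∘ η X ≈ f
  μ∘◇₁f∘η {f = f} = begin
    (μ _ ∘ ◇₁ f) ∘ η _      ≈⟨ assoc ⟩
    μ _ ∘ (◇₁ f ∘ η _)      ≈⟨ ∘-resp-≈ʳ η-natural ⟨
    μ _ ∘ (η _ ∘ f)         ≈⟨ sym-assoc ⟩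
    (μ _ ∘ η _) ∘ f         ≈⟨ ∘-resp-≈ˡ (∘-resp-≈ʳ η-idempotent) ⟩
    (μ _ ∘ ◇₁ (η _)) ∘ f    ≈⟨ ∘-resp-≈ˡ μ∘◇η ⟩
    id ∘ f                  ≈⟨ identityˡ ⟩
    f                       ∎

  project : ∀ {Θ Ξ} (w : Wk Θ Ξ) → Hom ⟦ Ξ ⟧ᶜ ⟦ keepLocks w ⟧ᶜ
  project done      = id
  project (keep w)  = first (project w)
  project (drop w)  = project w ∘ π₁
  project (keepL w) = ◇₁ (project w)
  project (dropL w) = ◇₁ (project w)

  insertLocks : ∀ {Θ Ξ} (w : Wk Θ Ξ) → Hom ⟦ Θ ⟧ᶜ ⟦ keepLocks w ⟧ᶜ
  insertLocks done      = id
  insertLocks (keep w)  = first (insertLocks w)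
  insertLocks (drop w)  = insertLocks w
  insertLocks (keepL w) = ◇₁ (insertLocks w)
  insertLocks (dropL w) = η _ ∘ insertLocks w

  project-idWk≈insertLocks-idWk : ∀ Γ → project (idWk Γ) ≈ insertLocks (idWk Γ)
  project-idWk≈insertLocks-idWk ∅       = ≈.refl
  project-idWk≈insertLocks-idWk (Γ ▹ A) = ⟨⟩-cong (∘-resp-≈ˡ (project-idWk≈insertLocks-idWk Γ)) ≈.refl
  project-idWk≈insertLocks-idWk (Γ ▹•)  = ◇-resp-≈ (project-idWk≈insertLocks-idWk Γ)

  record Factors {Θ Ξ} (w : Wk Θ Ξ) {Y} (f : Hom ⟦ Ξ ⟧ᶜ Y) (g : Hom ⟦ Θ ⟧ᶜ Y) : Set (ℓ ⊔ ℓ′) where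
    constructor factors
    field
      core        : Hom ⟦ keepLocks w ⟧ᶜ Y
      via-project : f ≈ core ∘ project w
      via-insert  : g ≈ core ∘ insertLocks w

  module _ {Θ Ξ} {w : Wk Θ Ξ} where

    Factors-∘ : ∀ {Y Z} {f g} (k : Hom Y Z) → Factors w f g → Factors w (k ∘ f) (k ∘ g)
    Factors-∘ k (factors h f≈ g≈) = factors (k ∘ h) (≈.trans (∘-resp-≈ʳ f≈) sym-assoc)
                                                    (≈.trans (∘-resp-≈ʳ g≈) sym-assoc)

    Factors-⟨⟩ : ∀ {Y Z} {f₁ g₁ f₂ g₂} → Factors w {Y} f₁ g₁ → Factors w {Z} f₂ g₂ →
                 Factors w ⟨ f₁ , f₂ ⟩ ⟨ g₁ , g₂ ⟩
    Factors-⟨⟩ (factors h₁ f₁≈ g₁≈) (factors h₂ f₂≈ g₂≈) =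
      factors ⟨ h₁ , h₂ ⟩ (≈.trans (⟨⟩-cong f₁≈ f₂≈) (≈.sym ⟨⟩∘)) (≈.trans (⟨⟩-cong g₁≈ g₂≈) (≈.sym ⟨⟩∘))

    Factors-keep : ∀ {A Y} {f g} → Factors w {Y} f g → Factors (keep {A = A} w) (f ∘ π₁) (g ∘ π₁)
    Factors-keep (factors h f≈ g≈) = factors (h ∘ π₁) (≈.trans (∘-resp-≈ˡ f≈) ∘π₁≈π₁∘first)
                                                      (≈.trans (∘-resp-≈ˡ g≈) ∘π₁≈π₁∘first)

    Factors-drop : ∀ {A Y} {f g} → Factors w {Y} f g → Factors (drop {A = A} w) (f ∘ π₁) g
    Factors-drop (factors h f≈ g≈) = factors h (≈.trans (∘-resp-≈ˡ f≈) assoc) g≈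

    Factors-curry : ∀ {A Y} {f g} → Factors (keep {A = A} w) {Y} f g → Factors w (curry f) (curry g)
    Factors-curry (factors h f≈ g≈) = factors (curry h) (≈.trans (curry-cong f≈) (≈.sym curry∘))
                                                        (≈.trans (curry-cong g≈) (≈.sym curry∘))

    Factors-shut : ∀ {Y} {f g} → Factors (keepL w) {Y} f g → Factors w (□₁ f ∘ ηᵐ) (□₁ g ∘ ηᵐ)
    Factors-shut (factors h f≈ g≈) = factors (□₁ h ∘ ηᵐ) (shut-resp f≈) (shut-resp g≈)
      where
      shut-resp : ∀ {X} {f : Hom (◇ X) _} {p : Hom X ⟦ keepLocks w ⟧ᶜ} →
                  f ≈ h ∘ ◇₁ p → □₁ f ∘ ηᵐ ≈ (□₁ h ∘ ηᵐ) ∘ p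
      shut-resp {f = f} {p} f≈ = begin
        □₁ f ∘ ηᵐ                  ≈⟨ ∘-resp-≈ˡ (□-resp-≈ f≈) ⟩
        □₁ (h ∘ ◇₁ p) ∘ ηᵐ         ≈⟨ ∘-resp-≈ˡ □-homo ⟩
        (□₁ h ∘ □₁ (◇₁ p)) ∘ ηᵐ    ≈⟨ assoc ⟩
        □₁ h ∘ (□₁ (◇₁ p) ∘ ηᵐ)    ≈⟨ ∘-resp-≈ʳ ηᵐ-natural ⟩
        □₁ h ∘ (ηᵐ ∘ p)            ≈⟨ sym-assoc ⟩
        (□₁ h ∘ ηᵐ) ∘ p            ∎

  record LockSquares {Θ Ξ Ξ₁ Ξ₂} (w : Wk Θ Ξ) (e : Ext Ξ₁ Ξ₂ Ξ) (s : Split Θ Ξ₁) : Set (ℓ ⊔ ℓ′) where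
    constructor squares
    field
      {Ξ̂₂}           : Ctx
      ê              : Ext (keepLocks (Split.wk₁ s)) Ξ̂₂ (keepLocks w)
      project-square : ◇₁ (project (Split.wk₁ s)) ∘ lock e ≈ lock ê ∘ project w
      insert-square  : ◇₁ (insertLocks (Split.wk₁ s)) ∘ lock (Split.ext₁ s) ≈ lock ê ∘ insertLocks w

  module _ {X X' Y Y'} {a : Hom X X'} {l : Hom Y (◇ X)} {l' : Hom Y' (◇ X')} {b : Hom Y Y'}
           (square : ◇₁ a ∘ l ≈ l' ∘ b) where

    square-first : ∀ {Z} → ◇₁ a ∘ (l ∘ π₁ {Y} {Z}) ≈ (l' ∘ π₁) ∘ first b
    square-first = begin
      ◇₁ a ∘ (l ∘ π₁)         ≈⟨ sym-assoc ⟩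
      (◇₁ a ∘ l) ∘ π₁         ≈⟨ ∘-resp-≈ˡ square ⟩
      (l' ∘ b) ∘ π₁           ≈⟨ ∘π₁≈π₁∘first ⟩
      (l' ∘ π₁) ∘ first b     ∎

    square-π₁ : ∀ {Z} → ◇₁ a ∘ (l ∘ π₁ {Y} {Z}) ≈ l' ∘ (b ∘ π₁)
    square-π₁ = ≈.trans sym-assoc (≈.trans (∘-resp-≈ˡ square) assoc)

    square-μ : ◇₁ a ∘ (μ X ∘ ◇₁ l) ≈ (μ X' ∘ ◇₁ l') ∘ ◇₁ b
    square-μ = begin
      ◇₁ a ∘ (μ X ∘ ◇₁ l)          ≈⟨ sym-assoc ⟩
      (◇₁ a ∘ μ X) ∘ ◇₁ l          ≈⟨ ∘-resp-≈ˡ μ-natural ⟩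
      (μ X' ∘ ◇₁ (◇₁ a)) ∘ ◇₁ l    ≈⟨ assoc ⟩
      μ X' ∘ (◇₁ (◇₁ a) ∘ ◇₁ l)    ≈⟨ ∘-resp-≈ʳ ◇-homo ⟨
      μ X' ∘ ◇₁ (◇₁ a ∘ l)         ≈⟨ ∘-resp-≈ʳ (◇-resp-≈ square) ⟩
      μ X' ∘ ◇₁ (l' ∘ b)           ≈⟨ ∘-resp-≈ʳ ◇-homo ⟩
      μ X' ∘ (◇₁ l' ∘ ◇₁ b)        ≈⟨ sym-assoc ⟩
      (μ X' ∘ ◇₁ l') ∘ ◇₁ b        ∎

    square-η : ◇₁ a ∘ l ≈ (μ X' ∘ ◇₁ l') ∘ (η Y' ∘ b)
    square-η = begin
      ◇₁ a ∘ l                     ≈⟨ square ⟩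
      l' ∘ b                       ≈⟨ ∘-resp-≈ˡ μ∘◇₁f∘η ⟨
      ((μ X' ∘ ◇₁ l') ∘ η Y') ∘ b  ≈⟨ assoc ⟩
      (μ X' ∘ ◇₁ l') ∘ (η Y' ∘ b)  ∎

  lock-squares : ∀ {Θ Ξ Ξ₁ Ξ₂} (w : Wk Θ Ξ) (e : Ext Ξ₁ Ξ₂ Ξ) → LockSquares w e (splitWk w e)
  lock-squares w base = squares base (≈.sym η-natural) (≈.sym η-natural)
  lock-squares (keep w) (ext e) with splitWk w e | lock-squares w e
  ... | split _ _ | squares ê p i = squares (ext ê) (square-first p) (square-first i)
  lock-squares (drop w) (ext e) with lock-squares w e
  ... | squares ê p i = squares ê (square-π₁ p) i
  lock-squares (keepL w) (extL e) with splitWk w e | lock-squares w e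
  ... | split _ _ | squares ê p i = squares (extL ê) (square-μ p) (square-μ i)
  lock-squares (dropL w) (extL e) with lock-squares w e
  ... | squares ê p i = squares (extL ê) (square-μ p) (square-η i)

  Factors-open : ∀ {Θ Ξ Ξ₁ Ξ₂ C} {w : Wk Θ Ξ} {e : Ext Ξ₁ Ξ₂ Ξ} {Θ₁ Θ₂} {w₁ : Wk Θ₁ Ξ₁} {e₁ : Ext Θ₁ Θ₂ Θ}
                 {f g} → LockSquares w e (split w₁ e₁) → Factors w₁ {□ C} f g →
                 Factors w (εᵐ ∘ ◇₁ f ∘ lock e) (εᵐ ∘ ◇₁ g ∘ lock e₁)
  Factors-open {w₁ = w₁} (squares ê p i) (factors h f≈ g≈) =
    factors (εᵐ ∘ ◇₁ h ∘ lock ê) (open-resp f≈ p) (open-resp g≈ i)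
    where
    open-resp : ∀ {X Y W} {f : Hom Y (□ _)} {a : Hom Y ⟦ keepLocks w₁ ⟧ᶜ} {l : Hom X (◇ Y)}
                  {l' : Hom W (◇ ⟦ keepLocks w₁ ⟧ᶜ)}
                  {b : Hom X W} → f ≈ h ∘ a → ◇₁ a ∘ l ≈ l' ∘ b → εᵐ ∘ ◇₁ f ∘ l ≈ (εᵐ ∘ ◇₁ h ∘ l') ∘ b
    open-resp {f = f} {a} {l} {l'} {b} f≈ square = begin
      εᵐ ∘ ◇₁ f ∘ l              ≈⟨ ∘-resp-≈ʳ (∘-resp-≈ˡ (◇-resp-≈ f≈)) ⟩
      εᵐ ∘ ◇₁ (h ∘ a) ∘ l        ≈⟨ ∘-resp-≈ʳ (∘-resp-≈ˡ ◇-homo) ⟩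
      εᵐ ∘ (◇₁ h ∘ ◇₁ a) ∘ l     ≈⟨ ∘-resp-≈ʳ assoc ⟩
      εᵐ ∘ ◇₁ h ∘ (◇₁ a ∘ l)     ≈⟨ ∘-resp-≈ʳ (∘-resp-≈ʳ square) ⟩
      εᵐ ∘ ◇₁ h ∘ (l' ∘ b)       ≈⟨ ∘-resp-≈ʳ sym-assoc ⟩
      εᵐ ∘ (◇₁ h ∘ l') ∘ b       ≈⟨ sym-assoc ⟩
      (εᵐ ∘ ◇₁ h ∘ l') ∘ b       ∎

  strVar-factors : ∀ {Θ Ξ A} (w : Wk Θ Ξ) (x : Var Ξ A) → All (λ x' → Factors w ⟦ x ⟧ⱽ ⟦ x' ⟧ⱽ) (strVar w x)
  strVar-factors (keep w) zero    = just (factors π₂ (≈.sym project₂) (≈.sym project₂))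
  strVar-factors (keep w) (suc x) = gmap Factors-keep (strVar-factors w x)
  strVar-factors (drop w) zero    = nothing
  strVar-factors (drop w) (suc x) = All.map Factors-drop (strVar-factors w x)

  strengthen-factors : ∀ {Θ Ξ A} (w : Wk Θ Ξ) (D : Tm Ξ A) →
                       All (λ D' → Factors w ⟦ D ⟧ ⟦ D' ⟧) (strengthen w D)
  strengthen-factors w (var x)    = map⁺ (strVar-factors w x)
  strengthen-factors w unit       = just (factors ! (≈.sym (!-unique _)) (≈.sym (!-unique _)))
  strengthen-factors w (pair t u) =
    >>=⁺ (strengthen-factors w t) λ t-factors → >>=⁺ (strengthen-factors w u) λ u-factors →
    just (Factors-⟨⟩ t-factors u-factors)
  strengthen-factors w (fst t)    = gmap (Factors-∘ π₁) (strengthen-factors w t)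
  strengthen-factors w (snd t)    = gmap (Factors-∘ π₂) (strengthen-factors w t)
  strengthen-factors w (lam t)    = gmap Factors-curry (strengthen-factors (keep w) t)
  strengthen-factors w (app t u)  =
    >>=⁺ (strengthen-factors w t) λ t-factors → >>=⁺ (strengthen-factors w u) λ u-factors →
    just (Factors-∘ eval (Factors-⟨⟩ t-factors u-factors))
  strengthen-factors w (shut t)   = gmap Factors-shut (strengthen-factors (keepL w) t)
  strengthen-factors w (open' e t) with splitWk w e | lock-squares w e
  ... | split w₁ _ | sq = gmap (Factors-open sq) (strengthen-factors w₁ t)

  η∘project≈◇₁insertLocks∘lock : ∀ {Γ Γ' Δ} (E : Ext Γ Γ' Δ) →
                                 η _ ∘ project (dropExt E) ≈ ◇₁ (insertLocks (dropExt E)) ∘ lock E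
  η∘project≈◇₁insertLocks∘lock {Γ} base =
    ≈.trans η-natural (∘-resp-≈ˡ (◇-resp-≈ (project-idWk≈insertLocks-idWk Γ)))
  η∘project≈◇₁insertLocks∘lock (ext E) =
    ≈.trans sym-assoc (≈.trans (∘-resp-≈ˡ (η∘project≈◇₁insertLocks∘lock E)) assoc)
  η∘project≈◇₁insertLocks∘lock {Γ} {Δ = Δ ▹•} (extL E) = begin
    η _ ∘ ◇₁ (project w)                              ≈⟨ ∘-resp-≈ˡ η-idempotent ⟩
    ◇₁ (η _) ∘ ◇₁ (project w)                         ≈⟨ ∘-resp-≈ʳ identityˡ ⟨
    ◇₁ (η _) ∘ (id ∘ ◇₁ (project w))                  ≈⟨ ∘-resp-≈ʳ (∘-resp-≈ˡ μ∘◇η) ⟨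
    ◇₁ (η _) ∘ ((μ _ ∘ ◇₁ (η _)) ∘ ◇₁ (project w))    ≈⟨ ∘-resp-≈ʳ (square-μ (≈.sym IH)) ⟨
    ◇₁ (η _) ∘ (◇₁ (insertLocks w) ∘ lock (extL E))   ≈⟨ sym-assoc ⟩
    (◇₁ (η _) ∘ ◇₁ (insertLocks w)) ∘ lock (extL E)   ≈⟨ ∘-resp-≈ˡ ◇-homo ⟨
    ◇₁ (η _ ∘ insertLocks w) ∘ lock (extL E)          ∎
    where
    w : Wk Γ Δ
    w = dropExt E
    IH : η _ ∘ project w ≈ ◇₁ (insertLocks w) ∘ lock E
    IH = η∘project≈◇₁insertLocks∘lock E

  Factors-dropExt : ∀ {Γ Γ' Δ Y} (E : Ext Γ Γ' Δ) {f g} → Factors (dropExt E) {Y} f g →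
                    η Y ∘ f ≈ ◇₁ g ∘ lock E
  Factors-dropExt {Γ} {Δ = Δ} E {f} {g} (factors h f≈ g≈) = begin
    η _ ∘ f                             ≈⟨ ∘-resp-≈ʳ f≈ ⟩
    η _ ∘ (h ∘ project w)               ≈⟨ sym-assoc ⟩
    (η _ ∘ h) ∘ project w               ≈⟨ ∘-resp-≈ˡ η-natural ⟩
    (◇₁ h ∘ η _) ∘ project w            ≈⟨ assoc ⟩
    ◇₁ h ∘ (η _ ∘ project w)            ≈⟨ ∘-resp-≈ʳ (η∘project≈◇₁insertLocks∘lock E) ⟩
    ◇₁ h ∘ (◇₁ (insertLocks w) ∘ lock E) ≈⟨ sym-assoc ⟩
    (◇₁ h ∘ ◇₁ (insertLocks w)) ∘ lock E ≈⟨ ∘-resp-≈ˡ ◇-homo ⟨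
    ◇₁ (h ∘ insertLocks w) ∘ lock E     ≈⟨ ∘-resp-≈ˡ (◇-resp-≈ g≈) ⟨
    ◇₁ g ∘ lock E                       ∎
    where
    w : Wk Γ Δ
    w = dropExt E

  strengthen-sound : ∀ {Γ Γ' Δ A} (E : Ext Γ Γ' Δ) (D : Tm Δ A) {D' : Tm Γ A} →
                     strengthen (dropExt E) D ≡ just D' → η ⟦ A ⟧ᵀ ∘ ⟦ D ⟧ ≈ ◇₁ ⟦ D' ⟧ ∘ lock E
  strengthen-sound E D D≡ =
    Factors-dropExt E (drop-just (subst (All _) D≡ (strengthen-factors (dropExt E) D)))

lemma8 : ∀ {o ℓ e} (M : Model o ℓ e) (ρ : ℕ → Model.Obj M)
           {Γ Γ' Δ : Ctx} {A : Ty} (E : Ext Γ Γ' Δ) (D : Tm Δ A) →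
           (∀ {B} (x : Mem Γ' B) → ¬ Free (inR E x) D) →
           let open Model M
               open Semantics M ρ
           in Σ (Tm Γ A) (λ D' → Σ (strengthen (dropExt E) D ≡ just D')
                (λ _ → η ⟦ A ⟧ᵀ ∘ ⟦ D ⟧ ≈ ◇₁ ⟦ D' ⟧ ∘ lock E))
lemma8 M ρ E D avoids with strengthen-just (dropExt E) D (dropExt-avoids E avoids)
... | D' , D≡ = D' , D≡ , strengthen-sound M ρ E D D≡
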